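{- Let $d\ge3$, $h\ge1$. In the sandpile group $G(d,h)$, the image $\bar{\mathbf{x}}_0$ of the basis vector corresponding to the root has order $d(d-1)^h$.
   Context: Let $\mathcal{T}(d,h)$ be the ball of radius $h$ about a root vertex $0$ in the infinite $d$-regular tree (root has $d$ children, vertices at depth $1,\dots,h-1$ have $d-1$ children, depth-$h$ vertices are leaves). Let $V$ be its vertex set, $p(i)$ the parent of $i\neq 0$, $C_i$ the children of $i$, $\{\mathbf{x}_i\}$ the standard basis of $\mathbb{Z}^V$, and $\delta_i = d\mathbf{x}_i - \mathbf{x}_{p(i)} - \sum_{j\in C_i}\mathbf{x}_j$ (omit $\mathbf{x}_{p(i)}$ for $i=0$; empty sum for leaves). The sandpile group is $G(d,h)=\mathbb{Z}^V/\sum_{i\in V}\mathbb{Z}\delta_i$, and $\bar{\mathbf{v}}$ denotes the image of $\mathbf{v}\in\mathbb{Z}^V$. -}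

module Defs where

open import Data.Nat as ℕ using (ℕ; zero; suc; _∸_; _<_)
open import Data.Nat.Properties using (n<1+n; <-trans; <-irrelevant)
open import Data.Integer as ℤ using (ℤ; +_; _*_; _-_; _+_; 0ℤ; 1ℤ)
open import Data.Fin as Fin using (Fin; toℕ)
open import Data.Fin.Properties using (toℕ<n) renaming (_≟_ to _≟F_)
open import Data.List using (List; []; _∷_; length; map; concatMap; foldr; _++_; allFin)
open import Data.List.Properties using () renaming (≡-dec to ≡-decL)
open import Data.Maybe using (Maybe; just; nothing)
open import Data.Maybe.Properties using () renaming (≡-dec to ≡-decM)
open import Data.Product using (Σ; _,_; _×_; ∃)
open import Relation.Binary.PropositionalEquality using (_≡_; refl; cong; subst; sym)
open import Relation.Nullary using (Dec; yes; no; ¬_)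

-- A non-root vertex at depth k+1 (k < h) is given by
-- the child index c ∈ Fin d chosen at the root, followed by a word w of
-- length k over Fin (d-1) recording the later child choices, stored with
-- the DEEPEST choice first (so the parent of  node c (x ∷ w)  is  node c w).
data V (d h : ℕ) : Set where
  root : V d h
  node : (c : Fin d) (w : List (Fin (d ∸ 1))) → length w < h → V d h

_≟V_ : ∀ {d h} → (i j : V d h) → Dec (i ≡ j)
root ≟V root = yes refl
root ≟V node _ _ _ = no (λ ())
node _ _ _ ≟V root = no (λ ())
node c w p ≟V node c' w' p' with c ≟F c' | ≡-decL _≟F_ w w'
... | yes refl | yes refl = yes (cong (node c w) (<-irrelevant p p'))
... | no ne | _ = no (λ { refl → ne refl })
... | yes _ | no ne = no (λ { refl → ne refl })

parent : ∀ {d h} → V d h → Maybe (V d h)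
parent root = nothing
parent (node c [] _) = just root
parent (node c (x ∷ w) p) = just (node c w (<-trans (n<1+n (length w)) p))

[_] : ∀ {A : Set} → Dec A → ℤ
[ yes _ ] = 1ℤ
[ no _ ] = 0ℤ

-- δ_i = d x_i − x_{p(i)} − Σ_{j ∈ C_i} x_j, given by its coordinates:
-- coordinate j is  d[j = i] − [j = p(i)] − [p(j) = i]   (j ∈ C_i ⇔ p(j) = i).
δ : ∀ {d h} → V d h → V d h → ℤ
δ {d} i j = (+ d) * [ j ≟V i ] - [ ≡-decM _≟V_ (just j) (parent i) ]
                                - [ ≡-decM _≟V_ (parent j) (just i) ]

words : (m k : ℕ) → List (Σ (List (Fin m)) λ w → length w ≡ k)
words m zero = ([] , refl) ∷ []
words m (suc k) =
  concatMap (λ { (w , e) → map (λ x → (x ∷ w) , cong suc e) (allFin m) }) (words m k)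

allV : (d h : ℕ) → List (V d h)
allV d h = root ∷ concatMap (λ c →
             concatMap (λ k →
               map (λ { (w , e) → node c w (subst (_< h) (sym e) (toℕ<n k)) })
                   (words (d ∸ 1) (toℕ k)))
               (allFin h))
             (allFin d)

ℤ^V : ℕ → ℕ → Set
ℤ^V d h = V d h → ℤ

𝐱 : ∀ {d h} → V d h → ℤ^V d h
𝐱 i j = [ j ≟V i ]

_·_ : ∀ {d h} → ℤ → ℤ^V d h → ℤ^V d h
(n · v) j = n * v j

combo : ∀ {d h} → ℤ^V d h → ℤ^V d h
combo {d} {h} a j = foldr _+_ 0ℤ (map (λ i → a i * δ i j) (allV d h))

-- membership in the subgroup Σ_i ℤ δ_i  (i.e. v̄ = 0 in G(d,h))
InL : ∀ {d h} → ℤ^V d h → Set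
InL {d} {h} v = Σ (ℤ^V d h) λ a → ∀ j → v j ≡ combo a j

HasOrder : ∀ {d h} → ℤ^V d h → ℕ → Set
HasOrder v n = (0 < n) × InL ((+ n) · v)
               × (∀ m → 0 < m → m < n → ¬ InL ((+ m) · v))

{-# OPTIONS --safe #-}
module Submission where

-- Put e = d − 1 and S n = 1 + e + ⋯ + eⁿ, and let the height of a vertex at depth k be h − k.
-- The vector a v = S (height v) satisfies Σᵢ aᵢ δᵢ = d eʰ 𝐱₀: at a vertex of height n + 1 with
-- e children and a parent, d S (n+1) = e S n + S (n+2); at a leaf d S 0 = S 1; at the root,
-- with d children, d S h − d S (h−1) = d eʰ.  Conversely, if m 𝐱₀ = Σᵢ aᵢ δᵢ, then Σᵢ aᵢ δᵢ
-- vanishes off the root, and induction from the leaves shows that on each edge from a vertex v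
-- of height n to its parent, a takes the values S n · l and S (n+1) · l for a single l;
-- the siblings below a vertex share this l because S (n+1) ≠ 0.  At the root this gives
-- m = d eʰ l, so d eʰ divides m.

open import Defs

-- A scope for the integer operators, which would clash with ℕ's in the statement at the end.
module _ where
  open import Data.Nat as ℕ using (ℕ; zero; suc; _∸_; _<_; _≤_; _^_; z≤n; s≤s; _<?_)
  import Data.Nat.Properties as ℕ
  open import Data.Nat.Divisibility using (∣⇒≤)
  open import Data.Integer using (ℤ; +_; 0ℤ; 1ℤ; _+_; _*_; _-_; -_)
  open import Data.Integer.Properties
    using ( +-identityˡ; +-identityʳ; +-assoc; +-inverseʳ; neg-distrib-+; pos-+; pos-*; suc-*
          ; *-identityˡ; *-identityʳ; *-zeroˡ; *-zeroʳ; *-comm; *-distribˡ-+; *-cancelˡ-≡; i-j≡0⇒i≡j )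
  open import Data.Integer.Divisibility.Signed using (_∣_; divides; ∣⇒∣ᵤ)
  open import Data.Integer.Tactic.RingSolver using (solve-∀)
  open import Data.Fin as Fin using (Fin; toℕ; fromℕ<)
  open import Data.Fin.Properties using (toℕ<n; toℕ-fromℕ<; toℕ-injective) renaming (_≟_ to _≟F_)
  open import Data.List using (List; []; _∷_; length; map; concatMap; foldr; _++_; allFin)
  open import Data.List.Properties using (map-tabulate; length-tabulate) renaming (≡-dec to ≡-decL)
  open import Data.Maybe using (just; nothing; maybe′)
  open import Data.Maybe.Properties using () renaming (≡-dec to ≡-decM)
  open import Data.Product using (∃-syntax; _×_; _,_; proj₁; swap)
  open import Function using (_∘_; id)
  open import Relation.Binary.Definitions using (DecidableEquality)
  open import Relation.Binary.PropositionalEquality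
    using (_≡_; refl; sym; trans; cong; cong₂; subst; module ≡-Reasoning)
  open import Relation.Nullary using (Dec; yes; no; ¬_; does; _×-dec_; contradiction)

  private
    variable
      A B : Set

  []-yes : A → (p : Dec A) → [ p ] ≡ 1ℤ
  []-yes a (yes _) = refl
  []-yes a (no ¬a) = contradiction a ¬a

  []-no : ¬ A → (p : Dec A) → [ p ] ≡ 0ℤ
  []-no ¬a (yes a) = contradiction a ¬a
  []-no ¬a (no _) = refl

  []-⇔ : (A → B) → (B → A) → (p : Dec A) (q : Dec B) → [ p ] ≡ [ q ]
  []-⇔ to from (yes a) q = sym ([]-yes (to a) q)
  []-⇔ to from (no ¬a) q = sym ([]-no (¬a ∘ from) q)

  -- The hypothesis is refl whenever p is a Dec.map′ of q: so for ≡-dec on just and on _∷_,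
  -- and for _≟_ on Fin.suc and on ℕ's suc.
  []-does : (p : Dec A) (q : Dec B) → does p ≡ does q → [ p ] ≡ [ q ]
  []-does (yes _) (yes _) _ = refl
  []-does (no _) (no _) _ = refl

  []-×-dec : (p : Dec A) (q : Dec B) → [ p ×-dec q ] ≡ [ p ] * [ q ]
  []-×-dec (yes _) (yes _) = refl
  []-×-dec (yes _) (no _) = refl
  []-×-dec (no _) q = sym (*-zeroˡ [ q ])

  ∑ : List A → (A → ℤ) → ℤ
  ∑ xs f = foldr _+_ 0ℤ (map f xs)

  infix 5 ∑
  syntax ∑ xs (λ x → t) = ∑[ x ∈ xs ] t

  ∑-cong : {f g : A → ℤ} → (∀ x → f x ≡ g x) → ∀ xs → ∑ xs f ≡ ∑ xs g
  ∑-cong f≗g [] = refl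
  ∑-cong f≗g (x ∷ xs) = cong₂ _+_ (f≗g x) (∑-cong f≗g xs)

  ∑-zero : {f : A → ℤ} → (∀ x → f x ≡ 0ℤ) → ∀ xs → ∑ xs f ≡ 0ℤ
  ∑-zero f≗0 [] = refl
  ∑-zero f≗0 (x ∷ xs) = cong₂ _+_ (f≗0 x) (∑-zero f≗0 xs)

  ∑-++ : (f : A → ℤ) (xs ys : List A) → ∑ (xs ++ ys) f ≡ ∑ xs f + ∑ ys f
  ∑-++ f [] ys = sym (+-identityˡ _)
  ∑-++ f (x ∷ xs) ys = trans (cong (_+_ (f x)) (∑-++ f xs ys)) (sym (+-assoc (f x) _ _))

  ∑-concatMap : (f : B → ℤ) (g : A → List B) (xs : List A) →
                ∑ (concatMap g xs) f ≡ ∑[ x ∈ xs ] ∑ (g x) f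
  ∑-concatMap f g [] = refl
  ∑-concatMap f g (x ∷ xs) =
    trans (∑-++ f (g x) (concatMap g xs)) (cong (_+_ (∑ (g x) f)) (∑-concatMap f g xs))

  ∑-map : (f : B → ℤ) (g : A → B) (xs : List A) → ∑ (map g xs) f ≡ ∑ xs (f ∘ g)
  ∑-map f g [] = refl
  ∑-map f g (x ∷ xs) = cong (_+_ (f (g x))) (∑-map f g xs)

  ∑-distrib-+ : (f g : A → ℤ) (xs : List A) → ∑[ x ∈ xs ] (f x + g x) ≡ ∑ xs f + ∑ xs g
  ∑-distrib-+ f g [] = refl
  ∑-distrib-+ f g (x ∷ xs) =
    trans (cong (_+_ (f x + g x)) (∑-distrib-+ f g xs)) (interchange (f x) (g x) _ _)
    where
    interchange : ∀ a b c d → (a + b) + (c + d) ≡ (a + c) + (b + d)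
    interchange = solve-∀

  ∑-neg : (f : A → ℤ) (xs : List A) → ∑[ x ∈ xs ] - f x ≡ - ∑ xs f
  ∑-neg f [] = refl
  ∑-neg f (x ∷ xs) = trans (cong (_+_ (- f x)) (∑-neg f xs)) (sym (neg-distrib-+ (f x) _))

  ∑-sub : (f g : A → ℤ) (xs : List A) → ∑[ x ∈ xs ] (f x - g x) ≡ ∑ xs f - ∑ xs g
  ∑-sub f g xs = trans (∑-distrib-+ f (-_ ∘ g) xs) (cong (_+_ (∑ xs f)) (∑-neg g xs))

  ∑-*ˡ : (c : ℤ) (f : A → ℤ) (xs : List A) → ∑[ x ∈ xs ] c * f x ≡ c * ∑ xs f
  ∑-*ˡ c f [] = sym (*-zeroʳ c)
  ∑-*ˡ c f (x ∷ xs) =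
    trans (cong (_+_ (c * f x)) (∑-*ˡ c f xs)) (sym (*-distribˡ-+ c (f x) _))

  ∑-*ʳ : (c : ℤ) (f : A → ℤ) (xs : List A) → ∑[ x ∈ xs ] f x * c ≡ ∑ xs f * c
  ∑-*ʳ c f xs = trans (∑-cong (λ x → *-comm (f x) c) xs) (trans (∑-*ˡ c f xs) (*-comm c _))

  ∑-swap : (f : A → B → ℤ) (xs : List A) (ys : List B) →
           ∑[ x ∈ xs ] ∑[ y ∈ ys ] f x y ≡ ∑[ y ∈ ys ] ∑[ x ∈ xs ] f x y
  ∑-swap f [] ys = sym (∑-zero (λ _ → refl) ys)
  ∑-swap f (x ∷ xs) ys =
    trans (cong (_+_ (∑ ys (f x))) (∑-swap f xs ys)) (sym (∑-distrib-+ (f x) _ ys))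

  ∑-const : (c : ℤ) (xs : List A) → ∑[ x ∈ xs ] c ≡ + length xs * c
  ∑-const c [] = refl
  ∑-const c (x ∷ xs) = trans (cong (_+_ c) (∑-const c xs)) (sym (suc-* (+ length xs) c))

  ∑-allFin-const : ∀ n (f : Fin n → ℤ) {c} → (∀ x → f x ≡ c) → ∑ (allFin n) f ≡ + n * c
  ∑-allFin-const n f {c} f≗c =
    trans (∑-cong f≗c (allFin n))
          (trans (∑-const c (allFin n)) (cong (λ m → + m * c) (length-tabulate {n = n} id)))

  ∑-allFin-suc : ∀ {n} (f : Fin (suc n) → ℤ) →
                 ∑ (allFin (suc n)) f ≡ f Fin.zero + (∑[ x ∈ allFin n ] f (Fin.suc x))
  ∑-allFin-suc {n} f = cong (_+_ (f Fin.zero))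
    (trans (cong (λ xs → ∑ xs f) (sym (map-tabulate id Fin.suc))) (∑-map f Fin.suc (allFin n)))

  ∑-select : (_≟_ : DecidableEquality A) (f : A → ℤ) (u : A) (xs : List A) →
             ∑[ x ∈ xs ] [ u ≟ x ] ≡ 1ℤ → ∑[ x ∈ xs ] f x * [ u ≟ x ] ≡ f u
  ∑-select _≟_ f u xs once = begin
    ∑[ x ∈ xs ] f x * [ u ≟ x ]   ≡⟨ ∑-cong weight xs ⟩
    ∑[ x ∈ xs ] f u * [ u ≟ x ]   ≡⟨ ∑-*ˡ (f u) _ xs ⟩
    f u * (∑[ x ∈ xs ] [ u ≟ x ]) ≡⟨ cong (f u *_) once ⟩
    f u * 1ℤ                      ≡⟨ *-identityʳ (f u) ⟩
    f u                           ∎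
    where
    open ≡-Reasoning
    weight : ∀ x → f x * [ u ≟ x ] ≡ f u * [ u ≟ x ]
    weight x with u ≟ x
    ... | yes refl = refl
    ... | no _ = trans (*-zeroʳ (f x)) (sym (*-zeroʳ (f u)))

  allFin-multiplicity : ∀ {n} (y : Fin n) → ∑[ x ∈ allFin n ] [ y ≟F x ] ≡ 1ℤ
  allFin-multiplicity {suc n} Fin.zero =
    trans (∑-allFin-suc {n} (λ x → [ Fin.zero ≟F x ]))
          (cong (_+_ 1ℤ) (∑-zero (λ _ → refl) (allFin n)))
  allFin-multiplicity {suc n} (Fin.suc y) =
    trans (∑-allFin-suc {n} (λ x → [ Fin.suc y ≟F x ]))
      (trans (+-identityˡ _)
        (trans (∑-cong (λ x → []-does _ _ refl) (allFin n)) (allFin-multiplicity y)))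

  allFin-toℕ-multiplicity : ∀ {h n} → n < h → ∑[ k ∈ allFin h ] [ n ℕ.≟ toℕ k ] ≡ 1ℤ
  allFin-toℕ-multiplicity {h} {n} n<h =
    trans (∑-cong (λ k → []-⇔ (λ n≡k → toℕ-injective (trans (toℕ-fromℕ< n<h) n≡k))
                              (λ k≡ → trans (sym (toℕ-fromℕ< n<h)) (cong toℕ k≡))
                              (n ℕ.≟ toℕ k) (fromℕ< n<h ≟F k)) (allFin h))
          (allFin-multiplicity (fromℕ< n<h))

  words-multiplicity : ∀ m k (w : List (Fin m)) →
                       ∑[ v ∈ words m k ] [ ≡-decL _≟F_ w (proj₁ v) ] ≡ [ length w ℕ.≟ k ]
  words-multiplicity m zero [] = refl
  words-multiplicity m zero (_ ∷ _) = refl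
  words-multiplicity m (suc k) [] =
    trans (∑-concatMap _ _ (words m k))
          (∑-zero (λ _ → trans (∑-map _ _ (allFin m)) (∑-zero (λ _ → refl) (allFin m))) (words m k))
  words-multiplicity m (suc k) (y ∷ w) = begin
      ∑[ v ∈ words m (suc k) ] [ ≡-decL _≟F_ (y ∷ w) (proj₁ v) ]
    ≡⟨ trans (∑-concatMap _ _ (words m k)) (∑-cong (λ _ → ∑-map _ _ (allFin m)) (words m k)) ⟩
      ∑[ v ∈ words m k ] ∑[ x ∈ allFin m ] [ ≡-decL _≟F_ (y ∷ w) (x ∷ proj₁ v) ]
    ≡⟨ ∑-cong (λ v → ∑-cong (λ x → []-cons x (proj₁ v)) (allFin m)) (words m k) ⟩
      ∑[ v ∈ words m k ] ∑[ x ∈ allFin m ] [ ≡-decL _≟F_ w (proj₁ v) ] * [ y ≟F x ]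
    ≡⟨ ∑-cong (λ v → ∑-select _≟F_ _ y (allFin m) (allFin-multiplicity y)) (words m k) ⟩
      ∑[ v ∈ words m k ] [ ≡-decL _≟F_ w (proj₁ v) ]
    ≡⟨ words-multiplicity m k w ⟩
      [ length w ℕ.≟ k ]
    ≡⟨ []-does _ _ refl ⟩
      [ suc (length w) ℕ.≟ suc k ] ∎
    where
    open ≡-Reasoning
    []-cons : ∀ x w′ → [ ≡-decL _≟F_ (y ∷ w) (x ∷ w′) ] ≡ [ ≡-decL _≟F_ w w′ ] * [ y ≟F x ]
    []-cons x w′ =
      trans ([]-does _ (y ≟F x ×-dec ≡-decL _≟F_ w w′) refl)
            (trans ([]-×-dec (y ≟F x) (≡-decL _≟F_ w w′)) (*-comm [ y ≟F x ] _))

  node-injective : ∀ {d h} {c c′ : Fin d} {w w′} {p : length w < h} {p′ : length w′ < h} →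
                   node c w p ≡ node c′ w′ p′ → c ≡ c′ × w ≡ w′
  node-injective refl = refl , refl

  []-node : ∀ {d h} {c c′ : Fin d} {w w′} (p : length w < h) (p′ : length w′ < h) →
            [ node c w p ≟V node c′ w′ p′ ] ≡ [ ≡-decL _≟F_ w w′ ] * [ c ≟F c′ ]
  []-node {c = c} {c′} {w} {w′} p p′ =
    trans ([]-⇔ (swap ∘ node-injective)
                (λ { (refl , refl) → cong (node c w) (ℕ.<-irrelevant p p′) })
                (node c w p ≟V node c′ w′ p′) (≡-decL _≟F_ w w′ ×-dec c ≟F c′))
          ([]-×-dec (≡-decL _≟F_ w w′) (c ≟F c′))

  []-child : ∀ {d h} {c c′ : Fin d} {x y w w′} (p : length w < h) (q : suc (length w) < h)
             (r : length w′ < h) (r′ : suc (length w′) < h) →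
             [ node c (x ∷ w) q ≟V node c′ (y ∷ w′) r′ ] ≡ [ node c w p ≟V node c′ w′ r ] * [ y ≟F x ]
  []-child {c = c} {c′} {x} {y} {w} {w′} p q r r′ =
    trans ([]-⇔ to from (node c (x ∷ w) q ≟V node c′ (y ∷ w′) r′)
                        (node c w p ≟V node c′ w′ r ×-dec y ≟F x))
          ([]-×-dec (node c w p ≟V node c′ w′ r) (y ≟F x))
    where
    to : node c (x ∷ w) q ≡ node c′ (y ∷ w′) r′ → node c w p ≡ node c′ w′ r × y ≡ x
    to refl = cong (node c w) (ℕ.<-irrelevant p r) , refl
    from : node c w p ≡ node c′ w′ r × y ≡ x → node c (x ∷ w) q ≡ node c′ (y ∷ w′) r′
    from (eq , refl) with node-injective eq
    ... | refl , refl = cong (node c (x ∷ w)) (ℕ.<-irrelevant q r′)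

  nodeAt : ∀ {d h} (c : Fin d) (k : Fin h) → ∃[ w ] length w ≡ toℕ k → V d h
  nodeAt {h = h} c k (w , e) = node c w (subst (_< h) (sym e) (toℕ<n k))

  ∑-allV : ∀ d h (f : V d h → ℤ) →
           ∑ (allV d h) f ≡
           f root + (∑[ c ∈ allFin d ] ∑[ k ∈ allFin h ] ∑[ v ∈ words (d ∸ 1) (toℕ k) ] f (nodeAt c k v))
  ∑-allV d h f = cong (_+_ (f root))
    (trans (∑-concatMap _ _ (allFin d)) (∑-cong (λ c →
      trans (∑-concatMap _ _ (allFin h)) (∑-cong (λ k → ∑-map _ _ (words (d ∸ 1) (toℕ k))) (allFin h)))
      (allFin d)))

  allV-multiplicity : ∀ {d h} (u : V d h) → ∑[ i ∈ allV d h ] [ u ≟V i ] ≡ 1ℤ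
  allV-multiplicity {d} {h} root =
    trans (∑-allV d h (λ i → [ root ≟V i ]))
          (cong (_+_ 1ℤ) (∑-zero (λ _ → ∑-zero (λ k → ∑-zero (λ _ → refl) (words (d ∸ 1) (toℕ k)))
                                                (allFin h))
                                 (allFin d)))
  allV-multiplicity {d} {h} (node c w p) = begin
      ∑[ i ∈ allV d h ] [ node c w p ≟V i ]
    ≡⟨ trans (∑-allV d h (λ i → [ node c w p ≟V i ])) (+-identityˡ _) ⟩
      ∑[ c′ ∈ allFin d ] ∑[ k ∈ allFin h ] ∑[ v ∈ words′ k ] [ node c w p ≟V nodeAt c′ k v ]
    ≡⟨ ∑-cong (λ c′ → ∑-cong (λ k → ∑-cong (λ v → []-node p _) (words′ k)) (allFin h)) (allFin d) ⟩
      ∑[ c′ ∈ allFin d ] ∑[ k ∈ allFin h ] ∑[ v ∈ words′ k ] [ ≡-decL _≟F_ w (proj₁ v) ] * [ c ≟F c′ ]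
    ≡⟨ ∑-cong (λ c′ → trans (∑-cong (λ k → ∑-*ʳ _ _ (words′ k)) (allFin h)) (∑-*ʳ _ _ (allFin h)))
              (allFin d) ⟩
      ∑[ c′ ∈ allFin d ] (∑[ k ∈ allFin h ] ∑[ v ∈ words′ k ] [ ≡-decL _≟F_ w (proj₁ v) ]) * [ c ≟F c′ ]
    ≡⟨ ∑-select _≟F_ (λ _ → ∑[ k ∈ allFin h ] ∑[ v ∈ words′ k ] [ ≡-decL _≟F_ w (proj₁ v) ]) c
                (allFin d) (allFin-multiplicity c) ⟩
      ∑[ k ∈ allFin h ] ∑[ v ∈ words′ k ] [ ≡-decL _≟F_ w (proj₁ v) ]
    ≡⟨ ∑-cong (λ k → words-multiplicity (d ∸ 1) (toℕ k) w) (allFin h) ⟩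
      ∑[ k ∈ allFin h ] [ length w ℕ.≟ toℕ k ]
    ≡⟨ allFin-toℕ-multiplicity p ⟩
      1ℤ ∎
    where
    open ≡-Reasoning
    words′ : (k : Fin h) → List (∃[ v ] length v ≡ toℕ k)
    words′ k = words (d ∸ 1) (toℕ k)

  ∑-allV-select : ∀ {d h} (a : V d h → ℤ) (u : V d h) → ∑[ i ∈ allV d h ] a i * [ u ≟V i ] ≡ a u
  ∑-allV-select {d} {h} a u = ∑-select _≟V_ a u (allV d h) (allV-multiplicity u)

  up : ∀ {d h} (c : Fin d) (w : List (Fin (d ∸ 1))) → length w < h → V d h
  up c [] _ = root
  up c (_ ∷ w) p = node c w (ℕ.<-trans (ℕ.n<1+n (length w)) p)

  parent-node : ∀ {d h} (c : Fin d) w (p : length w < h) → parent (node c w p) ≡ just (up c w p)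
  parent-node c [] p = refl
  parent-node c (_ ∷ w) p = refl

  children : ∀ {d h} → V d h → List (V d h)
  children {d} {h} root with 0 <? h
  ... | yes 0<h = map (λ c → node c [] 0<h) (allFin d)
  ... | no _ = []
  children {d} {h} (node c w _) with suc (length w) <? h
  ... | yes q = map (λ x → node c (x ∷ w) q) (allFin (d ∸ 1))
  ... | no _ = []

  children-root : ∀ {d h} (0<h : 0 < h) → children {d} root ≡ map (λ c → node c [] 0<h) (allFin d)
  children-root {h = h} 0<h with 0 <? h
  ... | yes 0<h′ = cong (λ r → map (λ c → node c [] r) _) (ℕ.<-irrelevant 0<h′ 0<h)
  ... | no h≯0 = contradiction 0<h h≯0

  children-inner : ∀ {d h} c w (p : length w < h) (q : suc (length w) < h) →
                   children (node {d} c w p) ≡ map (λ x → node c (x ∷ w) q) (allFin (d ∸ 1))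
  children-inner {h = h} c w p q with suc (length w) <? h
  ... | yes q′ = cong (λ r → map (λ x → node c (x ∷ w) r) _) (ℕ.<-irrelevant q′ q)
  ... | no ¬q = contradiction q ¬q

  children-leaf : ∀ {d h} c w (p : length w < h) → ¬ suc (length w) < h →
                  children (node {d} c w p) ≡ []
  children-leaf {h = h} c w p ¬q with suc (length w) <? h
  ... | yes q = contradiction q ¬q
  ... | no _ = refl

  children-indicator : ∀ {d h} (j i : V d h) →
                       [ ≡-decM _≟V_ (just j) (parent i) ] ≡ ∑[ c ∈ children j ] [ c ≟V i ]
  children-indicator {d} {h} root i with 0 <? h
  ... | no h≯0 = childless i
    where
    childless : ∀ i → [ ≡-decM _≟V_ (just root) (parent i) ] ≡ 0ℤ
    childless root = refl
    childless (node _ w p) = contradiction (ℕ.≤-<-trans z≤n p) h≯0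
  ... | yes 0<h = trans (at-root i) (sym (∑-map (λ c → [ c ≟V i ]) _ (allFin d)))
    where
    at-root : ∀ i → [ ≡-decM _≟V_ (just root) (parent i) ] ≡ ∑[ c ∈ allFin d ] [ node c [] 0<h ≟V i ]
    at-root root = sym (∑-zero (λ _ → refl) (allFin d))
    at-root (node c [] p) = sym (trans
      (∑-cong (λ c′ → []-⇔ (sym ∘ proj₁ ∘ node-injective)
                           (λ { refl → cong (node c′ []) (ℕ.<-irrelevant 0<h p) })
                           (node c′ [] 0<h ≟V node c [] p) (c ≟F c′))
              (allFin d))
      (allFin-multiplicity c))
    at-root (node c (_ ∷ _) p) =
      sym (∑-zero (λ c′ → []-no (λ ()) (node c′ [] 0<h ≟V node c _ p)) (allFin d))
  children-indicator {d} {h} (node c w p) i with suc (length w) <? h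
  ... | no ¬q = at-leaf i
    where
    at-leaf : ∀ i → [ ≡-decM _≟V_ (just (node c w p)) (parent i) ] ≡ 0ℤ
    at-leaf root = refl
    at-leaf (node _ [] _) = refl
    at-leaf (node c′ (_ ∷ w′) p′) = []-no (λ { refl → ¬q p′ }) _
  ... | yes q = trans (at-inner i) (sym (∑-map (λ c → [ c ≟V i ]) _ (allFin (d ∸ 1))))
    where
    at-inner : ∀ i → [ ≡-decM _≟V_ (just (node c w p)) (parent i) ] ≡
                     ∑[ x ∈ allFin (d ∸ 1) ] [ node c (x ∷ w) q ≟V i ]
    at-inner root = sym (∑-zero (λ _ → refl) (allFin (d ∸ 1)))
    at-inner (node c′ [] p′) =
      sym (∑-zero (λ x → []-no (λ ()) (node c (x ∷ w) q ≟V node c′ [] p′)) (allFin (d ∸ 1)))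
    at-inner (node c′ (y ∷ w′) p′) = sym (begin
        ∑[ x ∈ allFin (d ∸ 1) ] [ node c (x ∷ w) q ≟V node c′ (y ∷ w′) p′ ]
      ≡⟨ ∑-cong (λ x → []-child p q r p′) (allFin (d ∸ 1)) ⟩
        ∑[ x ∈ allFin (d ∸ 1) ] [ node c w p ≟V node c′ w′ r ] * [ y ≟F x ]
      ≡⟨ ∑-select _≟F_ (λ _ → [ node c w p ≟V node c′ w′ r ]) y (allFin (d ∸ 1))
                  (allFin-multiplicity y) ⟩
        [ node c w p ≟V node c′ w′ r ]
      ≡⟨ []-does _ _ refl ⟩
        [ ≡-decM _≟V_ (just (node c w p)) (just (node c′ w′ r)) ] ∎)
      where
      open ≡-Reasoning
      r : length w′ < h
      r = ℕ.<-trans (ℕ.n<1+n (length w′)) p′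

  ∑-children : ∀ {d h} (a : V d h → ℤ) (j : V d h) →
               ∑[ i ∈ allV d h ] a i * [ ≡-decM _≟V_ (just j) (parent i) ] ≡ ∑[ c ∈ children j ] a c
  ∑-children {d} {h} a j = begin
      ∑[ i ∈ allV d h ] a i * [ ≡-decM _≟V_ (just j) (parent i) ]
    ≡⟨ ∑-cong (λ i → cong (_*_ (a i)) (children-indicator j i)) (allV d h) ⟩
      ∑[ i ∈ allV d h ] a i * (∑[ c ∈ children j ] [ c ≟V i ])
    ≡⟨ ∑-cong (λ i → sym (∑-*ˡ (a i) _ (children j))) (allV d h) ⟩
      ∑[ i ∈ allV d h ] ∑[ c ∈ children j ] a i * [ c ≟V i ]
    ≡⟨ ∑-swap _ (allV d h) (children j) ⟩
      ∑[ c ∈ children j ] ∑[ i ∈ allV d h ] a i * [ c ≟V i ]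
    ≡⟨ ∑-cong (∑-allV-select a) (children j) ⟩
      ∑[ c ∈ children j ] a c ∎
    where open ≡-Reasoning

  ∑-parent : ∀ {d h} (a : V d h → ℤ) (j : V d h) →
             ∑[ i ∈ allV d h ] a i * [ ≡-decM _≟V_ (parent j) (just i) ] ≡ maybe′ a 0ℤ (parent j)
  ∑-parent {d} {h} a j with parent j
  ... | nothing = ∑-zero (λ i → *-zeroʳ (a i)) (allV d h)
  ... | just u =
    trans (∑-cong (λ i → cong (_*_ (a i)) ([]-does _ (u ≟V i) refl)) (allV d h)) (∑-allV-select a u)

  combo-at : ∀ {d h} (a : V d h → ℤ) (j : V d h) →
             combo a j ≡ + d * a j - (∑[ c ∈ children j ] a c) - maybe′ a 0ℤ (parent j)
  combo-at {d} {h} a j = begin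
      combo a j
    ≡⟨ ∑-cong (λ i → expand (a i) (+ d) [ j ≟V i ] _ _) (allV d h) ⟩
      ∑[ i ∈ allV d h ] (+ d * self i - fromChildren i - fromParent i)
    ≡⟨ trans (∑-sub (λ i → + d * self i - fromChildren i) fromParent (allV d h))
             (cong (_- ∑ (allV d h) fromParent)
                   (trans (∑-sub (λ i → + d * self i) fromChildren (allV d h))
                          (cong (_- ∑ (allV d h) fromChildren) (∑-*ˡ (+ d) self (allV d h))))) ⟩
      + d * ∑ (allV d h) self - ∑ (allV d h) fromChildren - ∑ (allV d h) fromParent
    ≡⟨ cong₂ _-_ (cong₂ _-_ (cong (_*_ (+ d)) (∑-allV-select a j)) (∑-children a j)) (∑-parent a j) ⟩
      + d * a j - (∑[ c ∈ children j ] a c) - maybe′ a 0ℤ (parent j) ∎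
    where
    open ≡-Reasoning
    self fromChildren fromParent : V d h → ℤ
    self i = a i * [ j ≟V i ]
    fromChildren i = a i * [ ≡-decM _≟V_ (just j) (parent i) ]
    fromParent i = a i * [ ≡-decM _≟V_ (parent j) (just i) ]
    expand : ∀ x D P Q R → x * (D * P - Q - R) ≡ D * (x * P) - x * Q - x * R
    expand = solve-∀

  combo-root : ∀ {d h} (a : V d h → ℤ) (0<h : 0 < h) →
               combo a root ≡ + d * a root - (∑[ c ∈ allFin d ] a (node c [] 0<h))
  combo-root {d} a 0<h =
    trans (combo-at a root)
          (trans (+-identityʳ _)
                 (cong (_-_ (+ d * a root))
                       (trans (cong (λ cs → ∑ cs a) (children-root 0<h)) (∑-map a _ (allFin d)))))

  combo-inner : ∀ {d h} (a : V d h → ℤ) c w (p : length w < h) (q : suc (length w) < h) →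
                combo a (node c w p) ≡
                + d * a (node c w p) - (∑[ x ∈ allFin (d ∸ 1) ] a (node c (x ∷ w) q)) - a (up c w p)
  combo-inner {d} a c w p q =
    trans (combo-at a (node c w p))
          (cong₂ (λ s t → + d * a (node c w p) - s - t)
                 (trans (cong (λ cs → ∑ cs a) (children-inner c w p q)) (∑-map a _ (allFin (d ∸ 1))))
                 (cong (maybe′ a 0ℤ) (parent-node c w p)))

  combo-leaf : ∀ {d h} (a : V d h → ℤ) c w (p : length w < h) → ¬ suc (length w) < h →
               combo a (node c w p) ≡ + d * a (node c w p) - a (up c w p)
  combo-leaf {d} a c w p ¬q =
    trans (combo-at a (node c w p))
          (trans (cong₂ (λ s t → + d * a (node c w p) - s - t)
                        (cong (λ cs → ∑ cs a) (children-leaf c w p ¬q))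
                        (cong (maybe′ a 0ℤ) (parent-node c w p)))
                 (cong (_- a (up c w p)) (+-identityʳ (+ d * a (node c w p)))))

  height : ∀ {d h} → V d h → ℕ
  height {h = h} root = h
  height {h = h} (node _ w _) = h ∸ suc (length w)

  ∸≡suc∸suc : ∀ {m n} → m < n → n ∸ m ≡ suc (n ∸ suc m)
  ∸≡suc∸suc m<n = ℕ.+-∸-assoc 1 m<n

  height-up : ∀ {d h} (c : Fin d) w (p : length w < h) → height (up c w p) ≡ suc (height (node c w p))
  height-up c [] p = ∸≡suc∸suc p
  height-up c (_ ∷ w) p = ∸≡suc∸suc p

  height-child : ∀ {d h} (c : Fin d) x w (p : length w < h) (q : suc (length w) < h) →
                 height (node c w p) ≡ suc (height (node c (x ∷ w) q))
  height-child c x w p q = ∸≡suc∸suc q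

  height-leaf : ∀ {d h} (c : Fin d) w (p : length w < h) → ¬ suc (length w) < h →
                height (node c w p) ≡ 0
  height-leaf c w p ¬q = ℕ.m≤n⇒m∸n≡0 (ℕ.≮⇒≥ ¬q)

  up-child : ∀ {d h} (c : Fin d) x w (p : length w < h) (q : suc (length w) < h) →
             up c (x ∷ w) q ≡ node c w p
  up-child c x w p q = cong (node c w) (ℕ.<-irrelevant _ p)

  geomSum : ℕ → ℕ → ℕ
  geomSum e zero = 1
  geomSum e (suc n) = suc (e ℕ.* geomSum e n)

  geomSum-suc : ∀ e n → geomSum e (suc n) ≡ geomSum e n ℕ.+ e ^ suc n
  geomSum-suc e zero = refl
  geomSum-suc e (suc n) =
    cong suc (trans (cong (e ℕ.*_) (geomSum-suc e n)) (ℕ.*-distribˡ-+ e (geomSum e n) (e ^ suc n)))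

  -- d ≥ 2 so that every inner vertex has a child, from which the descent reads off the scale.
  module RootOrder (k h′ : ℕ) where

    e d h N : ℕ
    e = suc k
    d = suc e
    h = suc h′
    N = d ℕ.* e ^ h

    S : ℕ → ℤ
    S n = + geomSum e n

    S-suc : ∀ n → S (suc n) ≡ 1ℤ + + e * S n
    S-suc n = trans (pos-+ 1 (e ℕ.* geomSum e n)) (cong (_+_ 1ℤ) (pos-* e (geomSum e n)))

    S-leaf : + d * S 0 ≡ S 1
    S-leaf = refl

    S-inner : ∀ n → + d * S (suc n) - + e * S n ≡ S (suc (suc n))
    S-inner n = begin
        + d * S (suc n) - + e * S n
      ≡⟨ cong (λ t → + d * t - + e * S n) (S-suc n) ⟩
        (1ℤ + + e) * (1ℤ + + e * S n) - + e * S n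
      ≡⟨ identity (+ e) (S n) ⟩
        1ℤ + + e * (1ℤ + + e * S n)
      ≡⟨ cong (λ t → 1ℤ + + e * t) (sym (S-suc n)) ⟩
        1ℤ + + e * S (suc n)
      ≡⟨ sym (S-suc (suc n)) ⟩
        S (suc (suc n)) ∎
      where
      open ≡-Reasoning
      identity : ∀ E s → (1ℤ + E) * (1ℤ + E * s) - E * s ≡ 1ℤ + E * (1ℤ + E * s)
      identity = solve-∀

    S-root : ∀ n → + d * S (suc n) - + d * S n ≡ + (d ℕ.* e ^ suc n)
    S-root n = begin
        + d * S (suc n) - + d * S n
      ≡⟨ cong (λ t → + d * t - + d * S n) (trans (cong +_ (geomSum-suc e n)) (pos-+ (geomSum e n) _)) ⟩
        + d * (S n + + (e ^ suc n)) - + d * S n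
      ≡⟨ identity (+ d) (S n) (+ (e ^ suc n)) ⟩
        + d * + (e ^ suc n)
      ≡⟨ sym (pos-* d (e ^ suc n)) ⟩
        + (d ℕ.* e ^ suc n) ∎
      where
      open ≡-Reasoning
      identity : ∀ D s t → D * (s + t) - D * s ≡ D * t
      identity = solve-∀

    0<h : 0 < h
    0<h = s≤s z≤n

    potential : V d h → ℤ
    potential v = S (height v)

    combo-potential : ∀ j → combo potential j ≡ + N * 𝐱 root j
    combo-potential root = begin
        combo potential root
      ≡⟨ combo-root potential 0<h ⟩
        + d * S h - (∑[ c ∈ allFin d ] S h′)
      ≡⟨ cong (_-_ (+ d * S h)) (∑-allFin-const d (λ _ → S h′) (λ _ → refl)) ⟩
        + d * S h - + d * S h′
      ≡⟨ S-root h′ ⟩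
        + N
      ≡⟨ sym (*-identityʳ (+ N)) ⟩
        + N * 1ℤ ∎
      where open ≡-Reasoning
    combo-potential (node c w p) with suc (length w) <? h
    ... | yes q = begin
        combo potential (node c w p)
      ≡⟨ combo-inner potential c w p q ⟩
        + d * S (height (node c w p)) - (∑[ x ∈ allFin e ] S n) - S (height (up c w p))
      ≡⟨ cong₂ (λ s m → + d * S (height (node c w p)) - s - S m)
               (∑-allFin-const e (λ _ → S n) (λ _ → refl)) (height-up c w p) ⟩
        + d * S (height (node c w p)) - + e * S n - S (suc (height (node c w p)))
      ≡⟨ cong (λ m → + d * S m - + e * S n - S (suc m)) (height-child c Fin.zero w p q) ⟩
        + d * S (suc n) - + e * S n - S (suc (suc n))
      ≡⟨ cong (_- S (suc (suc n))) (S-inner n) ⟩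
        S (suc (suc n)) - S (suc (suc n))
      ≡⟨ +-inverseʳ (S (suc (suc n))) ⟩
        0ℤ
      ≡⟨ sym (*-zeroʳ (+ N)) ⟩
        + N * 0ℤ ∎
      where
      open ≡-Reasoning
      n = h ∸ suc (suc (length w))
    ... | no ¬q = begin
        combo potential (node c w p)
      ≡⟨ combo-leaf potential c w p ¬q ⟩
        + d * S (height (node c w p)) - S (height (up c w p))
      ≡⟨ cong (λ m → + d * S (height (node c w p)) - S m) (height-up c w p) ⟩
        + d * S (height (node c w p)) - S (suc (height (node c w p)))
      ≡⟨ cong (λ m → + d * S m - S (suc m)) (height-leaf c w p ¬q) ⟩
        + d * S 0 - S 1
      ≡⟨ cong (_- S 1) S-leaf ⟩
        S 1 - S 1
      ≡⟨ +-inverseʳ (S 1) ⟩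
        0ℤ
      ≡⟨ sym (*-zeroʳ (+ N)) ⟩
        + N * 0ℤ ∎
      where open ≡-Reasoning

    root-multiple : InL ((+ N) · 𝐱 {d} {h} root)
    root-multiple = potential , λ j → sym (combo-potential j)

    factor-out : ∀ D s E t l → D * (s * l) - E * (t * l) ≡ (D * s - E * t) * l
    factor-out = solve-∀

    module HarmonicOffRoot (a : V d h → ℤ) (harmonic : ∀ c w p → combo a (node c w p) ≡ 0ℤ) where

      common-factor : ∀ {m n} (f : Fin (suc m) → V d h) (u : V d h) →
                      (∀ x → ∃[ l ] a (f x) ≡ S n * l × a u ≡ S (suc n) * l) →
                      ∃[ l ] (∀ x → a (f x) ≡ S n * l) × a u ≡ S (suc n) * l
      common-factor {n = n} f u factor with factor Fin.zero
      ... | l , _ , u≡ = l , f≡ , u≡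
        where
        f≡ : ∀ x → a (f x) ≡ S n * l
        f≡ x with factor x
        ... | lₓ , fx≡ , u≡ₓ =
          trans fx≡ (cong (_*_ (S n)) (*-cancelˡ-≡ (S (suc n)) lₓ l (trans (sym u≡ₓ) u≡)))

      leaf-step : ∀ c w (p : length w < h) → ¬ suc (length w) < h →
                  ∃[ l ] a (node c w p) ≡ S 0 * l × a (up c w p) ≡ S 1 * l
      leaf-step c w p ¬q = a (node c w p) , sym (*-identityˡ _) , (begin
          a (up c w p)
        ≡⟨ sym (i-j≡0⇒i≡j _ _ (trans (sym (combo-leaf a c w p ¬q)) (harmonic c w p))) ⟩
          + d * a (node c w p)
        ≡⟨ cong (_* a (node c w p)) (sym (*-identityʳ (+ d))) ⟩
          + d * S 0 * a (node c w p)
        ≡⟨ cong (_* a (node c w p)) S-leaf ⟩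
          S 1 * a (node c w p) ∎)
        where open ≡-Reasoning

      inner-step : ∀ n c w (p : length w < h) (q : suc (length w) < h) →
                   (∀ x → ∃[ l ] a (node c (x ∷ w) q) ≡ S n * l × a (node c w p) ≡ S (suc n) * l) →
                   ∃[ l ] a (node c w p) ≡ S (suc n) * l × a (up c w p) ≡ S (suc (suc n)) * l
      inner-step n c w p q factor with common-factor {n = n} (λ x → node c (x ∷ w) q) (node c w p) factor
      ... | l , children≡ , v≡ = l , v≡ , (begin
          a (up c w p)
        ≡⟨ sym (i-j≡0⇒i≡j _ _ (trans (sym (combo-inner a c w p q)) (harmonic c w p))) ⟩
          + d * a (node c w p) - (∑[ x ∈ allFin e ] a (node c (x ∷ w) q))
        ≡⟨ cong₂ (λ s t → + d * s - t) v≡ (∑-allFin-const e _ children≡) ⟩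
          + d * (S (suc n) * l) - + e * (S n * l)
        ≡⟨ factor-out (+ d) (S (suc n)) (+ e) (S n) l ⟩
          (+ d * S (suc n) - + e * S n) * l
        ≡⟨ cong (_* l) (S-inner n) ⟩
          S (suc (suc n)) * l ∎)
        where open ≡-Reasoning

      proportional-on-edge : ∀ n c w (p : length w < h) → height (node c w p) ≡ n →
                             ∃[ l ] a (node c w p) ≡ S n * l × a (up c w p) ≡ S (suc n) * l
      proportional-on-edge zero c w p ht with suc (length w) <? h
      ... | yes q = contradiction (trans (sym (height-child c Fin.zero w p q)) ht) λ ()
      ... | no ¬q = leaf-step c w p ¬q
      proportional-on-edge (suc n) c w p ht with suc (length w) <? h
      ... | no ¬q = contradiction (trans (sym ht) (height-leaf c w p ¬q)) λ ()
      ... | yes q = inner-step n c w p q λ x →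
        subst (λ u → ∃[ l ] a (node c (x ∷ w) q) ≡ S n * l × a u ≡ S (suc n) * l) (up-child c x w p q)
              (proportional-on-edge n c (x ∷ w) q
                 (ℕ.suc-injective (trans (sym (height-child c x w p q)) ht)))

      root-divisible : + N ∣ combo a root
      root-divisible
        with common-factor {n = h′} (λ c → node c [] 0<h) root
               (λ c → proportional-on-edge h′ c [] 0<h refl)
      ... | l , children≡ , root≡ = divides l (begin
          combo a root
        ≡⟨ combo-root a 0<h ⟩
          + d * a root - (∑[ c ∈ allFin d ] a (node c [] 0<h))
        ≡⟨ cong₂ (λ s t → + d * s - t) root≡ (∑-allFin-const d _ children≡) ⟩
          + d * (S h * l) - + d * (S h′ * l)
        ≡⟨ factor-out (+ d) (S h) (+ d) (S h′) l ⟩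
          (+ d * S h - + d * S h′) * l
        ≡⟨ cong (_* l) (S-root h′) ⟩
          + N * l
        ≡⟨ *-comm (+ N) l ⟩
          l * + N ∎)
        where open ≡-Reasoning

    no-smaller-multiple : ∀ m → 0 < m → m < N → ¬ InL ((+ m) · 𝐱 {d} {h} root)
    no-smaller-multiple m 0<m m<N (a , m𝐱≡) = ℕ.<⇒≱ m<N (∣⇒≤ {{ℕ.>-nonZero 0<m}} (∣⇒∣ᵤ N∣m))
      where
      harmonic : ∀ c w p → combo a (node c w p) ≡ 0ℤ
      harmonic c w p = trans (sym (m𝐱≡ (node c w p))) (*-zeroʳ (+ m))
      N∣m : + N ∣ + m
      N∣m = subst (_∣_ (+ N)) (trans (sym (m𝐱≡ root)) (*-identityʳ (+ m)))
                  (HarmonicOffRoot.root-divisible a harmonic)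

    hasOrder : HasOrder (𝐱 {d} {h} root) N
    hasOrder = ℕ.<-≤-trans (ℕ.m^n>0 e h) (ℕ.m≤m+n (e ^ h) _) , root-multiple , no-smaller-multiple

  root-order : ∀ d h → 2 ≤ d → 1 ≤ h → HasOrder (𝐱 {d} {h} root) (d ℕ.* (d ∸ 1) ^ h)
  root-order (suc (suc k)) (suc h′) _ _ = RootOrder.hasOrder k h′
  root-order zero _ () _
  root-order (suc zero) _ (s≤s ()) _
  root-order (suc (suc _)) zero _ ()

open import Data.Nat using (ℕ; _≤_; _*_; _∸_; _^_)
open import Data.Nat.Properties using (≤-trans; n≤1+n)

proposition7p2 : (d h : ℕ) → 3 ≤ d → 1 ≤ h →
    HasOrder (𝐱 {d} {h} root) (d * (d ∸ 1) ^ h)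
proposition7p2 d h 3≤d 1≤h = root-order d h (≤-trans (n≤1+n 2) 3≤d) 1≤h
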